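{- If $w\ge5$ or $q\ge5$, then there is a digit $a\in\mathcal{D}$ such that $a+\tau^{w-1}\in\mathcal{D}$. If either $w\ge4$ and $q\ge11$, or $w\ge8$, then there is a digit $b\in\mathcal{D}$ such that $b+\bar\tau\tau^{w-1}\in\mathcal{D}$.
   Context: Let $q\ge2$ be an integer, $p\in\{ -1,1\}$, $w\ge2$ an integer and $\tau=\frac p2+i\sqrt{q-\frac14}$, with complex conjugate $\bar\tau$; $\mathbb{Z}[\tau]=\{x+y\tau:x,y\in\mathbb{Z}\}$. $\mathcal{D}$ is the minimal norm digit set modulo $\tau^w$: $0$ together with, for each residue class of $\mathbb{Z}[\tau]$ modulo $\tau^w$ not divisible by $\tau$, its representative of minimal absolute value. -}

module Defs where

open import Data.Integer using (ℤ; +_; -_; _+_; _-_; _*_; _≤_; -1ℤ; 0ℤ; 1ℤ)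
open import Data.Nat using (ℕ; zero; suc)
open import Data.Product using (_×_; _,_; ∃)
open import Data.Sum using (_⊎_)
open import Relation.Nullary using (¬_)
open import Relation.Binary.PropositionalEquality using (_≡_)

-- An element x + y·τ of ℤ[τ] is represented by the pair (x , y).
-- τ = p/2 + i·√(q − 1/4) satisfies τ² = p·τ − q (τ + τ̄ = p, τ·τ̄ = q),
-- so ℤ[τ] = {x + yτ} is a free ℤ-module with basis 1, τ.
Zτ : Set
Zτ = ℤ × ℤ

module Arith (p q : ℤ) where

  zero' : Zτ
  zero' = (0ℤ , 0ℤ)

  one' : Zτ
  one' = (1ℤ , 0ℤ)

  _⊕_ : Zτ → Zτ → Zτ
  (a , b) ⊕ (c , d) = (a + c , b + d)

  _⊖_ : Zτ → Zτ → Zτ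
  (a , b) ⊖ (c , d) = (a - c , b - d)

  -- (a + bτ)(c + dτ) = ac + (ad + bc)τ + bd τ² , with τ² = pτ − q
  _⊗_ : Zτ → Zτ → Zτ
  (a , b) ⊗ (c , d) = (a * c - q * (b * d) , a * d + b * c + p * (b * d))

  τ : Zτ
  τ = (0ℤ , 1ℤ)

  -- complex conjugate τ̄ = p − τ
  τbar : Zτ
  τbar = (p , -1ℤ)

  _^'_ : Zτ → ℕ → Zτ
  z ^' zero = one'
  z ^' suc n = z ⊗ (z ^' n)

  -- |x + yτ|² = x² + p·x·y + q·y²  (using p² = 1); minimal absolute value
  -- is the same as minimal value of this norm.
  normSq : Zτ → ℤ
  normSq (x , y) = x * x + p * (x * y) + q * (y * y)

  _∣'_ : Zτ → Zτ → Set
  m ∣' a = ∃ λ c → c ⊗ m ≡ a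

  CongMod : Zτ → Zτ → Zτ → Set
  CongMod m a b = m ∣' (a ⊖ b)

  record IsMinNormDigitSet (w : ℕ) (D : Zτ → Set) : Set where
    field
      zero∈D    : D zero'
      members   : ∀ d → D d → d ≡ zero' ⊎ (¬ (τ ∣' d))
      minimal   : ∀ d → D d → ¬ (τ ∣' d) →
                  ∀ β → CongMod (τ ^' w) β d → normSq d ≤ normSq β
      covers    : ∀ α → ¬ (τ ∣' α) → ∃ λ d → D d × CongMod (τ ^' w) d α
      unique    : ∀ d d′ → D d → D d′ → ¬ (τ ∣' d) →
                  CongMod (τ ^' w) d d′ → d ≡ d′

{-# OPTIONS --safe #-}
module Submission where

-- Write N for the norm form and B for its polar form, so N (a + b) = N a + B a b + N b, and
-- N (k a ± b) ≥ 0 gives |k B a b| ≤ k² N a + N b.  Put m = τ^w.  If u = 2α satisfies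
-- N u < 2 N m and |B u m| < 2 N m, then α is strictly shorter than every other element of
-- α + m ℤ[τ]: for c = ±1 this is the bound on B u m, and for every other c ≠ 0 one has
-- N (c m) ≥ 2 N m.  If moreover q does not divide the first coordinate of α, then τ ∤ α and
-- the minimality forces α ∈ D.  For t = τ^(w-1) or τ̄ τ^(w-1), both multiples of τ, round
-- -t/2 to some b with 2b = -t + e, N e ≤ q + 6 and q not dividing the first coordinate of b.
-- Then also 2(b + t) = t + e, so b and b + t are digits as soon as u = ±t + e satisfy the two
-- conditions; with r = q^(w-1) these reduce to r + q + 6 < q r for the first claim and to
-- 4 q (q + 6) < r for the second.

open import Data.Nat using (ℕ)
import Data.Nat as ℕ
open import Data.Product using (_×_; _,_; proj₁; proj₂; ∃)
open import Data.Sum using (_⊎_; inj₁; inj₂)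
open import Relation.Binary.PropositionalEquality

module Margins where
  open import Data.Nat using (_≤_; _<_; _+_; _*_; _^_; _∸_; s≤s; z≤n; >-nonZero)
  open import Data.Nat.Properties
  import Data.Nat.Tactic.RingSolver as ℕSolver

  <-by-excess : ∀ {m n} k → n ≡ m + ℕ.suc k → m < n
  <-by-excess {m} k refl = m<m+n m (s≤s z≤n)

  -- Each margin substitutes q = q₀ + i (and r = r₀ + j) and exhibits the excess as a polynomial
  -- in i and j with nonnegative coefficients.

  short-margin : ∀ {q r} → (5 ≤ q × q ≤ r) ⊎ (2 ≤ q × 16 ≤ r) → r + (6 + q) < q * r
  short-margin {q} {r} (inj₁ (5≤q , q≤r)) =
    subst (λ r → r + (6 + q) < q * r) (m+[n∸m]≡n q≤r)
      (subst (λ q → q + j + (6 + q) < q * (q + j)) (m+[n∸m]≡n 5≤q) (margin (q ∸ 5) j))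
    where
    j : ℕ
    j = r ∸ q
    margin : ∀ i j → (5 + i) + j + (6 + (5 + i)) < (5 + i) * ((5 + i) + j)
    margin i j = <-by-excess (8 + 8 * i + i * i + 4 * j + i * j) (identity i j)
      where
      identity : ∀ i j → (5 + i) * ((5 + i) + j) ≡ (5 + i) + j + (6 + (5 + i)) + ℕ.suc (8 + 8 * i + i * i + 4 * j + i * j)
      identity = ℕSolver.solve-∀
  short-margin {q} {r} (inj₂ (2≤q , 16≤r)) =
    subst₂ (λ q r → r + (6 + q) < q * r) (m+[n∸m]≡n 2≤q) (m+[n∸m]≡n 16≤r) (margin (q ∸ 2) (r ∸ 16))
    where
    margin : ∀ i j → 16 + j + (6 + (2 + i)) < (2 + i) * (16 + j)
    margin i j = <-by-excess (7 + j + 15 * i + i * j) (identity i j)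
      where
      identity : ∀ i j → (2 + i) * (16 + j) ≡ 16 + j + (6 + (2 + i)) + ℕ.suc (7 + j + 15 * i + i * j)
      identity = ℕSolver.solve-∀

  long-margin : ∀ {q r} → (11 ≤ q × q ^ 3 ≤ r) ⊎ (2 ≤ q × 16 * q ^ 3 ≤ r) → 4 * (q * (6 + q)) < r
  long-margin {q} (inj₁ (11≤q , q³≤r)) =
    <-≤-trans (subst (λ q → 4 * (q * (6 + q)) < q ^ 3) (m+[n∸m]≡n 11≤q) (margin (q ∸ 11))) q³≤r
    where
    margin : ∀ i → 4 * ((11 + i) * (6 + (11 + i))) < (11 + i) ^ 3
    margin i = <-by-excess (582 + 251 * i + 29 * (i * i) + i * i * i) (identity i)
      where
      identity : ∀ i → (11 + i) * ((11 + i) * ((11 + i) * 1)) ≡ 4 * ((11 + i) * (6 + (11 + i))) + ℕ.suc (582 + 251 * i + 29 * (i * i) + i * i * i)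
      identity = ℕSolver.solve-∀
  long-margin {q} (inj₂ (2≤q , 16q³≤r)) =
    <-≤-trans (subst (λ q → 4 * (q * (6 + q)) < 16 * q ^ 3) (m+[n∸m]≡n 2≤q) (margin (q ∸ 2))) 16q³≤r
    where
    margin : ∀ i → 4 * ((2 + i) * (6 + (2 + i))) < 16 * (2 + i) ^ 3
    margin i = <-by-excess (63 + 152 * i + 92 * (i * i) + 16 * (i * i * i)) (identity i)
      where
      identity : ∀ i → 16 * ((2 + i) * ((2 + i) * ((2 + i) * 1))) ≡ 4 * ((2 + i) * (6 + (2 + i))) + ℕ.suc (63 + 152 * i + 92 * (i * i) + 16 * (i * i * i))
      identity = ℕSolver.solve-∀

  long-margin⇒six-margin : ∀ {q r} → 2 ≤ q → 4 * (q * (6 + q)) < r → 6 * (6 + q) < q * r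
  long-margin⇒six-margin {q} {r} 2≤q four-margin = begin-strict
    6 * (6 + q)          ≤⟨ *-monoˡ-≤ (6 + q) (≤-trans (s≤s (s≤s (s≤s (s≤s (s≤s (s≤s z≤n)))))) (*-monoʳ-≤ 4 2≤q)) ⟩
    4 * q * (6 + q)      ≡⟨ *-assoc 4 q (6 + q) ⟩
    4 * (q * (6 + q))    <⟨ four-margin ⟩
    r                    ≤⟨ m≤n*m r q {{>-nonZero (<-≤-trans (s≤s z≤n) 2≤q)}} ⟩
    q * r                ∎
    where open ≤-Reasoning

  module _ {q w : ℕ} (2≤q : 2 ≤ q) where
    private instance
      q≢0 : ℕ.NonZero q
      q≢0 = >-nonZero (<-≤-trans (s≤s z≤n) 2≤q)

    τ-power-short-margin : 1 ≤ w → 5 ≤ ℕ.suc w ⊎ 5 ≤ q → q ^ w + (6 + q) < q * q ^ w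
    τ-power-short-margin _ (inj₁ (s≤s 4≤w)) = short-margin (inj₂ (2≤q , ≤-trans (^-monoˡ-≤ 4 2≤q) (^-monoʳ-≤ q 4≤w)))
    τ-power-short-margin 1≤w (inj₂ 5≤q) = short-margin (inj₁ (5≤q , subst (_≤ q ^ w) (*-identityʳ q) (^-monoʳ-≤ q 1≤w)))

    τ-power-long-margin : (4 ≤ ℕ.suc w × 11 ≤ q) ⊎ 8 ≤ ℕ.suc w → 4 * (q * (6 + q)) < q ^ w
    τ-power-long-margin (inj₁ (s≤s 3≤w , 11≤q)) = long-margin (inj₁ (11≤q , ^-monoʳ-≤ q 3≤w))
    τ-power-long-margin (inj₂ (s≤s 7≤w)) = long-margin (inj₂ (2≤q , (begin
      16 * q ^ 3       ≤⟨ *-monoˡ-≤ (q ^ 3) (^-monoˡ-≤ 4 2≤q) ⟩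
      q ^ 4 * q ^ 3    ≡⟨ ^-distribˡ-+-* q 4 3 ⟨
      q ^ 7            ≤⟨ ^-monoʳ-≤ q 7≤w ⟩
      q ^ w            ∎)))
      where open ≤-Reasoning

open import Defs
open import Data.Empty using (⊥-elim)
open import Data.Integer using (ℤ; +_; -[1+_]; -_; _+_; _-_; _*_; _≤_; _<_; +≤+; +<+; -1ℤ; 0ℤ; 1ℤ; NonNegative; nonNegative; positive)
import Data.Integer.DivMod as DivMod
open import Data.Integer.Divisibility.Signed using (_∣_; _∣?_; divides; ∣-refl; ∣m∣n⇒∣m-n; ∣m+n∣n⇒∣m; ∣n⇒∣m*n; ∣m⇒∣m*n; ∣⇒∣ᵤ)
open import Data.Integer.Properties
open import Data.Integer.Tactic.RingSolver using (solve-∀)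
open import Data.Nat.Divisibility using (∣1⇒≡1)
import Data.Nat.Properties as ℕ
open import Data.Product.Properties using (≡-dec)
open import Function using (_∘_)
open import Relation.Nullary using (¬_; yes; no)
open import Relation.Nullary.Decidable using (True; toWitness)

IsSign : ℤ → Set
IsSign s = s ≡ 1ℤ ⊎ s ≡ -1ℤ

IsBit : ℤ → Set
IsBit r = r ≡ 0ℤ ⊎ r ≡ 1ℤ

sign*sign≡1 : ∀ {s} → IsSign s → s * s ≡ 1ℤ
sign*sign≡1 (inj₁ refl) = refl
sign*sign≡1 (inj₂ refl) = refl

bit-of-<2 : ∀ {r} → r ℕ.< 2 → IsBit (+ r)
bit-of-<2 {ℕ.zero} _ = inj₁ refl
bit-of-<2 {1} _ = inj₂ refl
bit-of-<2 {ℕ.suc (ℕ.suc _)} (ℕ.s≤s (ℕ.s≤s ()))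

closed-≤ : ∀ {i j} {i≤?j : True (i ≤? j)} → i ≤ j
closed-≤ {i≤?j = i≤?j} = toWitness i≤?j

-- The first coordinate e₁ ∈ {-2, -1, 0, 1} of a rounding error is written as a bit r or as r - 2.
error-quadratic≤6 : ∀ {s r e₁ e₂} → IsSign s → IsBit r → (e₁ ≡ r ⊎ e₁ ≡ r - + 2) → IsBit e₂ →
                    e₁ * e₁ + s * (e₁ * e₂) ≤ + 6
error-quadratic≤6 (inj₁ refl) (inj₁ refl) (inj₁ refl) (inj₁ refl) = closed-≤
error-quadratic≤6 (inj₁ refl) (inj₁ refl) (inj₁ refl) (inj₂ refl) = closed-≤
error-quadratic≤6 (inj₁ refl) (inj₁ refl) (inj₂ refl) (inj₁ refl) = closed-≤
error-quadratic≤6 (inj₁ refl) (inj₁ refl) (inj₂ refl) (inj₂ refl) = closed-≤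
error-quadratic≤6 (inj₁ refl) (inj₂ refl) (inj₁ refl) (inj₁ refl) = closed-≤
error-quadratic≤6 (inj₁ refl) (inj₂ refl) (inj₁ refl) (inj₂ refl) = closed-≤
error-quadratic≤6 (inj₁ refl) (inj₂ refl) (inj₂ refl) (inj₁ refl) = closed-≤
error-quadratic≤6 (inj₁ refl) (inj₂ refl) (inj₂ refl) (inj₂ refl) = closed-≤
error-quadratic≤6 (inj₂ refl) (inj₁ refl) (inj₁ refl) (inj₁ refl) = closed-≤
error-quadratic≤6 (inj₂ refl) (inj₁ refl) (inj₁ refl) (inj₂ refl) = closed-≤
error-quadratic≤6 (inj₂ refl) (inj₁ refl) (inj₂ refl) (inj₁ refl) = closed-≤
error-quadratic≤6 (inj₂ refl) (inj₁ refl) (inj₂ refl) (inj₂ refl) = closed-≤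
error-quadratic≤6 (inj₂ refl) (inj₂ refl) (inj₁ refl) (inj₁ refl) = closed-≤
error-quadratic≤6 (inj₂ refl) (inj₂ refl) (inj₁ refl) (inj₂ refl) = closed-≤
error-quadratic≤6 (inj₂ refl) (inj₂ refl) (inj₂ refl) (inj₁ refl) = closed-≤
error-quadratic≤6 (inj₂ refl) (inj₂ refl) (inj₂ refl) (inj₂ refl) = closed-≤

square-nonNeg : ∀ i → 0ℤ ≤ i * i
square-nonNeg (+ ℕ.zero) = +≤+ ℕ.z≤n
square-nonNeg (+ ℕ.suc n) = +≤+ ℕ.z≤n
square-nonNeg -[1+ n ] = +≤+ ℕ.z≤n

nonzero-square-positive : ∀ {i} → i ≢ 0ℤ → 1ℤ ≤ i * i
nonzero-square-positive {+ ℕ.zero} i≢0 = ⊥-elim (i≢0 refl)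
nonzero-square-positive {+ ℕ.suc n} _ = +≤+ (ℕ.s≤s ℕ.z≤n)
nonzero-square-positive { -[1+ n ]} _ = +≤+ (ℕ.s≤s ℕ.z≤n)

*-nonNeg : ∀ {i j} → 0ℤ ≤ i → 0ℤ ≤ j → 0ℤ ≤ i * j
*-nonNeg {i} {j} 0≤i 0≤j = subst (_≤ i * j) (*-zeroʳ i) (*-monoˡ-≤-nonNeg i {{nonNegative 0≤i}} {0ℤ} {j} 0≤j)

-y<x⇒0<x+y : ∀ {x y} → - y < x → 0ℤ < x + y
-y<x⇒0<x+y {x} {y} -y<x = subst (_< x + y) (+-inverseˡ y) (+-monoˡ-< y -y<x)

shift-half : ∀ {b t e} → + 2 * b ≡ -1ℤ * t + e → + 2 * (b + t) ≡ 1ℤ * t + e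
shift-half {b} {t} {e} 2b≡-t+e = trans (identity₁ b t) (trans (cong (_+ + 2 * t) 2b≡-t+e) (identity₂ t e))
  where
  identity₁ : ∀ b t → + 2 * (b + t) ≡ + 2 * b + + 2 * t
  identity₁ = solve-∀
  identity₂ : ∀ t e → -1ℤ * t + e + + 2 * t ≡ 1ℤ * t + e
  identity₂ = solve-∀

infix 4 ∣_∣≤_ ∣_∣<_

∣_∣≤_ : ℤ → ℤ → Set
∣ x ∣≤ y = - y ≤ x × x ≤ y

∣_∣<_ : ℤ → ℤ → Set
∣ x ∣< y = - y < x × x < y

nonNeg⇒∣∣≤self : ∀ {x} → 0ℤ ≤ x → ∣ x ∣≤ x
nonNeg⇒∣∣≤self 0≤x = ≤-trans (neg-mono-≤ 0≤x) 0≤x , ≤-refl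

sign-∣∣≤ : ∀ {s x y} → IsSign s → ∣ x ∣≤ y → ∣ s * x ∣≤ y
sign-∣∣≤ {x = x} (inj₁ refl) bound rewrite *-identityˡ x = bound
sign-∣∣≤ {x = x} {y} (inj₂ refl) (lower , upper) rewrite -1*i≡-i x =
  neg-mono-≤ upper , subst (- x ≤_) (neg-involutive y) (neg-mono-≤ lower)

sign-∣∣< : ∀ {s x y} → IsSign s → ∣ x ∣< y → ∣ s * x ∣< y
sign-∣∣< {x = x} (inj₁ refl) bound rewrite *-identityˡ x = bound
sign-∣∣< {x = x} {y} (inj₂ refl) (lower , upper) rewrite -1*i≡-i x =
  neg-mono-< upper , subst (- x <_) (neg-involutive y) (neg-mono-< lower)

∣∣≤-weaken : ∀ {x a b} → a ≤ b → ∣ x ∣≤ a → ∣ x ∣≤ b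
∣∣≤-weaken a≤b (lower , upper) = ≤-trans (neg-mono-≤ a≤b) lower , ≤-trans upper a≤b

∣∣≤-<-trans : ∀ {x a b} → ∣ x ∣≤ a → a < b → ∣ x ∣< b
∣∣≤-<-trans (lower , upper) a<b = <-≤-trans (neg-mono-< a<b) lower , ≤-<-trans upper a<b

∣∣≤-+ : ∀ {x y a b} → ∣ x ∣≤ a → ∣ y ∣≤ b → ∣ x + y ∣≤ a + b
∣∣≤-+ {a = a} {b} (x-lower , x-upper) (y-lower , y-upper) =
  subst (_≤ _) (sym (neg-distrib-+ a b)) (+-mono-≤ x-lower y-lower) , +-mono-≤ x-upper y-upper

∣∣≤-+-∣∣< : ∀ {x y a b} → ∣ x ∣≤ a → ∣ y ∣< b → ∣ x + y ∣< a + b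
∣∣≤-+-∣∣< {a = a} {b} (x-lower , x-upper) (y-lower , y-upper) =
  subst (_< _) (sym (neg-distrib-+ a b)) (+-mono-≤-< x-lower y-lower) , +-mono-≤-< x-upper y-upper

∣∣<-cancel : ∀ k {x y} .{{_ : NonNegative k}} → ∣ k * x ∣< k * y → ∣ x ∣< y
∣∣<-cancel k {x} {y} (lower , upper) =
  *-cancelˡ-<-nonNeg k (subst (_< k * x) (neg-distribʳ-* k y) lower) , *-cancelˡ-<-nonNeg k upper

module NormForm (p Q : ℤ) where
  open Arith p Q

  B : Zτ → Zτ → ℤ
  B (x₁ , y₁) (x₂ , y₂) = + 2 * (x₁ * x₂) + p * (x₁ * y₂ + y₁ * x₂) + + 2 * (Q * (y₁ * y₂))

  infixr 7 _·_
  _·_ : ℤ → Zτ → Zτ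
  k · (x , y) = (k * x , k * y)

  N-⊕ : ∀ a b → normSq (a ⊕ b) ≡ normSq a + B a b + normSq b
  N-⊕ (x₁ , y₁) (x₂ , y₂) = identity p Q x₁ y₁ x₂ y₂
    where
    identity : ∀ p Q x₁ y₁ x₂ y₂ →
      (x₁ + x₂) * (x₁ + x₂) + p * ((x₁ + x₂) * (y₁ + y₂)) + Q * ((y₁ + y₂) * (y₁ + y₂))
      ≡ (x₁ * x₁ + p * (x₁ * y₁) + Q * (y₁ * y₁))
        + (+ 2 * (x₁ * x₂) + p * (x₁ * y₂ + y₁ * x₂) + + 2 * (Q * (y₁ * y₂)))
        + (x₂ * x₂ + p * (x₂ * y₂) + Q * (y₂ * y₂))
    identity = solve-∀

  N-⊗ : ∀ a b → normSq (a ⊗ b) ≡ normSq a * normSq b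
  N-⊗ (x₁ , y₁) (x₂ , y₂) = identity p Q x₁ y₁ x₂ y₂
    where
    identity : ∀ p Q x₁ y₁ x₂ y₂ →
      (x₁ * x₂ - Q * (y₁ * y₂)) * (x₁ * x₂ - Q * (y₁ * y₂))
        + p * ((x₁ * x₂ - Q * (y₁ * y₂)) * (x₁ * y₂ + y₁ * x₂ + p * (y₁ * y₂)))
        + Q * ((x₁ * y₂ + y₁ * x₂ + p * (y₁ * y₂)) * (x₁ * y₂ + y₁ * x₂ + p * (y₁ * y₂)))
      ≡ (x₁ * x₁ + p * (x₁ * y₁) + Q * (y₁ * y₁)) * (x₂ * x₂ + p * (x₂ * y₂) + Q * (y₂ * y₂))
    identity = solve-∀

  N-· : ∀ k a → normSq (k · a) ≡ k * k * normSq a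
  N-· k (x , y) = identity p Q k x y
    where
    identity : ∀ p Q k x y →
      (k * x) * (k * x) + p * ((k * x) * (k * y)) + Q * ((k * y) * (k * y))
      ≡ k * k * (x * x + p * (x * y) + Q * (y * y))
    identity = solve-∀

  N-sign· : ∀ {s} → IsSign s → ∀ a → normSq (s · a) ≡ normSq a
  N-sign· {s} s-sign a = trans (N-· s a) (trans (cong (_* normSq a) (sign*sign≡1 s-sign)) (*-identityˡ (normSq a)))

  N-real : ∀ x → normSq (x , 0ℤ) ≡ x * x
  N-real x = identity p Q x
    where
    identity : ∀ p Q x → x * x + p * (x * 0ℤ) + Q * (0ℤ * 0ℤ) ≡ x * x
    identity = solve-∀

  B-comm : ∀ a b → B a b ≡ B b a
  B-comm (x₁ , y₁) (x₂ , y₂) = identity p Q x₁ y₁ x₂ y₂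
    where
    identity : ∀ p Q x₁ y₁ x₂ y₂ →
      + 2 * (x₁ * x₂) + p * (x₁ * y₂ + y₁ * x₂) + + 2 * (Q * (y₁ * y₂))
      ≡ + 2 * (x₂ * x₁) + p * (x₂ * y₁ + y₂ * x₁) + + 2 * (Q * (y₂ * y₁))
    identity = solve-∀

  B-·ˡ : ∀ k a b → B (k · a) b ≡ k * B a b
  B-·ˡ k (x₁ , y₁) (x₂ , y₂) = identity p Q k x₁ y₁ x₂ y₂
    where
    identity : ∀ p Q k x₁ y₁ x₂ y₂ →
      + 2 * ((k * x₁) * x₂) + p * ((k * x₁) * y₂ + (k * y₁) * x₂) + + 2 * (Q * ((k * y₁) * y₂))
      ≡ k * (+ 2 * (x₁ * x₂) + p * (x₁ * y₂ + y₁ * x₂) + + 2 * (Q * (y₁ * y₂)))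
    identity = solve-∀

  B-·ʳ : ∀ k a b → B a (k · b) ≡ k * B a b
  B-·ʳ k a b = trans (B-comm a (k · b)) (trans (B-·ˡ k b a) (cong (k *_) (B-comm b a)))

  B-⊕ˡ : ∀ a b c → B (a ⊕ b) c ≡ B a c + B b c
  B-⊕ˡ (x₁ , y₁) (x₂ , y₂) (x₃ , y₃) = identity p Q x₁ y₁ x₂ y₂ x₃ y₃
    where
    identity : ∀ p Q x₁ y₁ x₂ y₂ x₃ y₃ →
      + 2 * ((x₁ + x₂) * x₃) + p * ((x₁ + x₂) * y₃ + (y₁ + y₂) * x₃) + + 2 * (Q * ((y₁ + y₂) * y₃))
      ≡ (+ 2 * (x₁ * x₃) + p * (x₁ * y₃ + y₁ * x₃) + + 2 * (Q * (y₁ * y₃)))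
        + (+ 2 * (x₂ * x₃) + p * (x₂ * y₃ + y₂ * x₃) + + 2 * (Q * (y₂ * y₃)))
    identity = solve-∀

  N-·⊕ : ∀ k a b → normSq ((k · a) ⊕ b) ≡ k * k * normSq a + k * B a b + normSq b
  N-·⊕ k a b = begin
    normSq ((k · a) ⊕ b)                      ≡⟨ N-⊕ (k · a) b ⟩
    normSq (k · a) + B (k · a) b + normSq b   ≡⟨ cong₂ (λ u v → u + v + normSq b) (N-· k a) (B-·ˡ k a b) ⟩
    k * k * normSq a + k * B a b + normSq b   ∎
    where open ≡-Reasoning

  two-N-⊕ : ∀ a b → + 2 * normSq (a ⊕ b) ≡ + 2 * normSq a + (B (+ 2 · a) b + + 2 * normSq b)
  two-N-⊕ a b = begin
    + 2 * normSq (a ⊕ b)                                ≡⟨ cong (+ 2 *_) (N-⊕ a b) ⟩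
    + 2 * (normSq a + B a b + normSq b)                 ≡⟨ identity (normSq a) (B a b) (normSq b) ⟩
    + 2 * normSq a + (+ 2 * B a b + + 2 * normSq b)     ≡⟨ cong (λ z → + 2 * normSq a + (z + + 2 * normSq b)) (B-·ˡ (+ 2) a b) ⟨
    + 2 * normSq a + (B (+ 2 · a) b + + 2 * normSq b)   ∎
    where
    open ≡-Reasoning
    identity : ∀ A C D → + 2 * (A + C + D) ≡ + 2 * A + (+ 2 * C + + 2 * D)
    identity = solve-∀

  scalar-⊗ : ∀ k a → (k , 0ℤ) ⊗ a ≡ k · a
  scalar-⊗ k (x , y) = cong₂ _,_ (identity₁ p Q k x y) (identity₂ p Q k x y)
    where
    identity₁ : ∀ p Q k x y → k * x - Q * (0ℤ * y) ≡ k * x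
    identity₁ = solve-∀
    identity₂ : ∀ p Q k x y → k * y + 0ℤ * x + p * (0ℤ * y) ≡ k * y
    identity₂ = solve-∀

  ·-⊗ : ∀ k c m → (k · c) ⊗ m ≡ k · (c ⊗ m)
  ·-⊗ k (c₁ , c₂) (m₁ , m₂) = cong₂ _,_ (identity₁ p Q k c₁ c₂ m₁ m₂) (identity₂ p Q k c₁ c₂ m₁ m₂)
    where
    identity₁ : ∀ p Q k c₁ c₂ m₁ m₂ → (k * c₁) * m₁ - Q * ((k * c₂) * m₂) ≡ k * (c₁ * m₁ - Q * (c₂ * m₂))
    identity₁ = solve-∀
    identity₂ : ∀ p Q k c₁ c₂ m₁ m₂ →
      (k * c₁) * m₂ + (k * c₂) * m₁ + p * ((k * c₂) * m₂) ≡ k * (c₁ * m₂ + c₂ * m₁ + p * (c₂ * m₂))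
    identity₂ = solve-∀

  ⊕-⊖-cancel : ∀ a d → a ⊕ (d ⊖ a) ≡ d
  ⊕-⊖-cancel (x₁ , y₁) (x₂ , y₂) = cong₂ _,_ (identity x₁ x₂) (identity y₁ y₂)
    where
    identity : ∀ a d → a + (d - a) ≡ d
    identity = solve-∀

  -1·-⊖ : ∀ a d → -1ℤ · (d ⊖ a) ≡ a ⊖ d
  -1·-⊖ (x₁ , y₁) (x₂ , y₂) = cong₂ _,_ (identity x₁ x₂) (identity y₁ y₂)
    where
    identity : ∀ a d → -1ℤ * (d - a) ≡ a - d
    identity = solve-∀

  ⊕-zero⊗ : ∀ a m → a ⊕ (zero' ⊗ m) ≡ a
  ⊕-zero⊗ (x , y) (m₁ , m₂) = cong₂ _,_ (identity₁ p Q x m₁ m₂) (identity₂ p Q y m₁ m₂)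
    where
    identity₁ : ∀ p Q a m₁ m₂ → a + (0ℤ * m₁ - Q * (0ℤ * m₂)) ≡ a
    identity₁ = solve-∀
    identity₂ : ∀ p Q a m₁ m₂ → a + (0ℤ * m₂ + 0ℤ * m₁ + p * (0ℤ * m₂)) ≡ a
    identity₂ = solve-∀

  N-τ⊗ : ∀ v → normSq (τ ⊗ v) ≡ Q * normSq v
  N-τ⊗ v = trans (N-⊗ τ v) (cong (_* normSq v) (identity p Q))
    where
    identity : ∀ p Q → 0ℤ * 0ℤ + p * (0ℤ * 1ℤ) + Q * (1ℤ * 1ℤ) ≡ Q
    identity = solve-∀

  N-τbar⊗ : ∀ v → normSq (τbar ⊗ v) ≡ Q * normSq v
  N-τbar⊗ v = trans (N-⊗ τbar v) (cong (_* normSq v) (identity p Q))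
    where
    identity : ∀ p Q → p * p + p * (p * -1ℤ) + Q * (-1ℤ * -1ℤ) ≡ Q
    identity = solve-∀

  B-τ⊗ : ∀ v → B v (τ ⊗ v) ≡ p * normSq v
  B-τ⊗ (x , y) = identity p Q x y
    where
    identity : ∀ p Q x y →
      + 2 * (x * (0ℤ * x - Q * (1ℤ * y))) + p * (x * (0ℤ * y + 1ℤ * x + p * (1ℤ * y)) + y * (0ℤ * x - Q * (1ℤ * y)))
        + + 2 * (Q * (y * (0ℤ * y + 1ℤ * x + p * (1ℤ * y))))
      ≡ p * (x * x + p * (x * y) + Q * (y * y))
    identity = solve-∀

  B-τbar⊗-τ⊗ : ∀ v → B (τbar ⊗ v) (τ ⊗ v) ≡ (p * p - + 2 * Q) * normSq v
  B-τbar⊗-τ⊗ (x , y) = identity p Q x y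
    where
    identity : ∀ p Q x y →
      + 2 * ((p * x - Q * (-1ℤ * y)) * (0ℤ * x - Q * (1ℤ * y)))
        + p * ((p * x - Q * (-1ℤ * y)) * (0ℤ * y + 1ℤ * x + p * (1ℤ * y)) + (p * y + -1ℤ * x + p * (-1ℤ * y)) * (0ℤ * x - Q * (1ℤ * y)))
        + + 2 * (Q * ((p * y + -1ℤ * x + p * (-1ℤ * y)) * (0ℤ * y + 1ℤ * x + p * (1ℤ * y))))
      ≡ (p * p - + 2 * Q) * (x * x + p * (x * y) + Q * (y * y))
    identity = solve-∀

module Digits (p : ℤ) (q : ℕ) (p-sign : IsSign p) (2≤q : 2 ℕ.≤ q) where
  open Arith p (+ q)
  open NormForm p (+ q)

  7≤4q-1 : + 7 ≤ + 4 * + q - 1ℤ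
  7≤4q-1 = +-monoˡ-≤ -1ℤ (*-monoˡ-≤-nonNeg (+ 4) (+≤+ 2≤q))

  0≤4q-1 : 0ℤ ≤ + 4 * + q - 1ℤ
  0≤4q-1 = ≤-trans (+≤+ ℕ.z≤n) 7≤4q-1

  [4q-1]y²≤4N : ∀ x y → (+ 4 * + q - 1ℤ) * (y * y) ≤ + 4 * normSq (x , y)
  [4q-1]y²≤4N x y = begin
    (+ 4 * + q - 1ℤ) * (y * y)                                            ≤⟨ i≤j+i _ _ {{nonNegative (square-nonNeg (+ 2 * x + p * y))}} ⟩
    (+ 2 * x + p * y) * (+ 2 * x + p * y) + (+ 4 * + q - 1ℤ) * (y * y)    ≡⟨ cong (λ c → (+ 2 * x + p * y) * (+ 2 * x + p * y) + (+ 4 * + q - c) * (y * y)) (sign*sign≡1 p-sign) ⟨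
    (+ 2 * x + p * y) * (+ 2 * x + p * y) + (+ 4 * + q - p * p) * (y * y) ≡⟨ identity p (+ q) x y ⟨
    + 4 * normSq (x , y)                                                  ∎
    where
    open ≤-Reasoning
    identity : ∀ p Q x y → + 4 * (x * x + p * (x * y) + Q * (y * y)) ≡ (+ 2 * x + p * y) * (+ 2 * x + p * y) + (+ 4 * Q - p * p) * (y * y)
    identity = solve-∀

  N-nonNeg : ∀ a → 0ℤ ≤ normSq a
  N-nonNeg (x , y) = *-cancelˡ-≤-pos 0ℤ (normSq (x , y)) (+ 4) (≤-trans (*-nonNeg 0≤4q-1 (square-nonNeg y)) ([4q-1]y²≤4N x y))

  B-bound : ∀ k a b → ∣ k * B a b ∣≤ k * k * normSq a + normSq b
  B-bound k a b =
      0≤i-j⇒j≤i (subst (0ℤ ≤_) (trans (N-·⊕ k a b) (lower-identity k (normSq a) (B a b) (normSq b))) (N-nonNeg ((k · a) ⊕ b)))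
    , 0≤i-j⇒j≤i (subst (0ℤ ≤_) (trans (N-·⊕ (- k) a b) (upper-identity k (normSq a) (B a b) (normSq b))) (N-nonNeg ((- k · a) ⊕ b)))
    where
    lower-identity : ∀ k A C D → k * k * A + k * C + D ≡ k * C - - (k * k * A + D)
    lower-identity = solve-∀
    upper-identity : ∀ k A C D → (- k) * (- k) * A + (- k) * C + D ≡ k * k * A + D - k * C
    upper-identity = solve-∀

  B-bound₁ : ∀ a b → ∣ B a b ∣≤ normSq a + normSq b
  B-bound₁ a b = subst₂ ∣_∣≤_ (*-identityˡ (B a b)) (cong (_+ normSq b) (*-identityˡ (normSq a))) (B-bound 1ℤ a b)

  7≤4*n⇒2≤n : ∀ n → + 7 ≤ + 4 * n → + 2 ≤ n
  7≤4*n⇒2≤n (+ ℕ.zero) (+≤+ ())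
  7≤4*n⇒2≤n (+ 1) (+≤+ (ℕ.s≤s (ℕ.s≤s (ℕ.s≤s (ℕ.s≤s ())))))
  7≤4*n⇒2≤n (+ ℕ.suc (ℕ.suc n)) _ = +≤+ (ℕ.s≤s (ℕ.s≤s ℕ.z≤n))
  7≤4*n⇒2≤n -[1+ n ] ()

  nonzero-classification : ∀ c → c ≢ zero' → (∃ λ s → IsSign s × c ≡ (s , 0ℤ)) ⊎ + 2 ≤ normSq c
  nonzero-classification (x , y) c≢0 with y ≟ 0ℤ
  ... | no y≢0 = inj₂ (7≤4*n⇒2≤n (normSq (x , y)) (begin
    + 7                             ≤⟨ 7≤4q-1 ⟩
    + 4 * + q - 1ℤ                  ≡⟨ *-identityʳ _ ⟨
    (+ 4 * + q - 1ℤ) * 1ℤ           ≤⟨ *-monoˡ-≤-nonNeg (+ 4 * + q - 1ℤ) {{nonNegative 0≤4q-1}} (nonzero-square-positive y≢0) ⟩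
    (+ 4 * + q - 1ℤ) * (y * y)      ≤⟨ [4q-1]y²≤4N x y ⟩
    + 4 * normSq (x , y)            ∎))
    where open ≤-Reasoning
  ... | yes refl = real-case x (c≢0 ∘ cong (_, 0ℤ))
    where
    real-case : ∀ x → x ≢ 0ℤ → (∃ λ s → IsSign s × (x , 0ℤ) ≡ (s , 0ℤ)) ⊎ + 2 ≤ normSq (x , 0ℤ)
    real-case (+ ℕ.zero) x≢0 = ⊥-elim (x≢0 refl)
    real-case (+ 1) _ = inj₁ (1ℤ , inj₁ refl , refl)
    real-case -[1+ 0 ] _ = inj₁ (-1ℤ , inj₂ refl , refl)
    real-case x@(+ ℕ.suc (ℕ.suc n)) _ = inj₂ (subst (+ 2 ≤_) (sym (N-real x)) (+≤+ (ℕ.s≤s (ℕ.s≤s ℕ.z≤n))))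
    real-case x@(-[1+ ℕ.suc n ]) _ = inj₂ (subst (+ 2 ≤_) (sym (N-real x)) (+≤+ (ℕ.s≤s (ℕ.s≤s ℕ.z≤n))))

  Central : Zτ → Zτ → Set
  Central m u = normSq u < + 2 * normSq m × ∣ B u m ∣< + 2 * normSq m

  StrictlyMinimal : Zτ → Zτ → Set
  StrictlyMinimal m α = ∀ c → c ≢ zero' → normSq α < normSq (α ⊕ (c ⊗ m))

  central⇒strictlyMinimal : ∀ {m α} → Central m (+ 2 · α) → StrictlyMinimal m α
  central⇒strictlyMinimal {m} {α} (N2α< , ∣B2α∣<) c c≢0 = *-cancelˡ-<-nonNeg (+ 2) (begin-strict
    + 2 * normSq α                                       ≡⟨ +-identityʳ _ ⟨
    + 2 * normSq α + 0ℤ                                  <⟨ +-monoʳ-< (+ 2 * normSq α) increment>0 ⟩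
    + 2 * normSq α + (B (+ 2 · α) y + + 2 * normSq y)    ≡⟨ two-N-⊕ α y ⟨
    + 2 * normSq (α ⊕ y)                                 ∎)
    where
    open ≤-Reasoning
    y : Zτ
    y = c ⊗ m
    increment>0 : 0ℤ < B (+ 2 · α) y + + 2 * normSq y
    increment>0 with nonzero-classification c c≢0
    ... | inj₁ (s , s-sign , refl) =
      subst (λ z → 0ℤ < B (+ 2 · α) z + + 2 * normSq z) (sym (scalar-⊗ s m))
        (subst₂ (λ u v → 0ℤ < u + + 2 * v) (sym (B-·ʳ s (+ 2 · α) m)) (sym (N-sign· s-sign m))
          (-y<x⇒0<x+y (proj₁ (sign-∣∣< s-sign ∣B2α∣<))))
    ... | inj₂ 2≤Nc = begin-strict
      0ℤ                                                   ≡⟨ +-inverseʳ (normSq (+ 2 · α)) ⟨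
      normSq (+ 2 · α) - normSq (+ 2 · α)                  <⟨ +-monoˡ-< (- normSq (+ 2 · α)) N2α< ⟩
      + 2 * normSq m - normSq (+ 2 · α)                    ≤⟨ +-monoˡ-≤ (- normSq (+ 2 · α)) 2Nm≤Ny ⟩
      normSq y - normSq (+ 2 · α)                          ≡⟨ identity (normSq (+ 2 · α)) (normSq y) ⟩
      - (normSq (+ 2 · α) + normSq y) + + 2 * normSq y     ≤⟨ +-monoˡ-≤ (+ 2 * normSq y) (proj₁ (B-bound₁ (+ 2 · α) y)) ⟩
      B (+ 2 · α) y + + 2 * normSq y                       ∎
      where
      2Nm≤Ny : + 2 * normSq m ≤ normSq y
      2Nm≤Ny = subst (+ 2 * normSq m ≤_) (sym (N-⊗ c m)) (*-monoʳ-≤-nonNeg (normSq m) {{nonNegative (N-nonNeg m)}} 2≤Nc)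
      identity : ∀ A Y → Y - A ≡ - (A + Y) + + 2 * Y
      identity = solve-∀

  central-⊕-short : ∀ {m t e K} → normSq m ≡ + q * normSq t → ∣ B t m ∣≤ normSq t → normSq e ≤ K →
                    normSq t + K < + q * normSq t → Central m (t ⊕ e)
  central-⊕-short {m} {t} {e} {K} Nm≡qNt ∣Btm∣≤Nt Ne≤K short = N< , ∣B∣<
    where
    open ≤-Reasoning
    R : ℤ
    R = normSq t
    N< : normSq (t ⊕ e) < + 2 * normSq m
    N< = begin-strict
      normSq (t ⊕ e)                  ≡⟨ N-⊕ t e ⟩
      R + B t e + normSq e            ≤⟨ +-mono-≤ (+-monoʳ-≤ R (≤-trans (proj₂ (B-bound₁ t e)) (+-monoʳ-≤ R Ne≤K))) Ne≤K ⟩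
      R + (R + K) + K                 ≡⟨ identity R K ⟩
      + 2 * (R + K)                   <⟨ *-monoˡ-<-pos (+ 2) short ⟩
      + 2 * (+ q * R)                 ≡⟨ cong (+ 2 *_) Nm≡qNt ⟨
      + 2 * normSq m                  ∎
      where
      identity : ∀ R K → R + (R + K) + K ≡ + 2 * (R + K)
      identity = solve-∀
    ∣Bem∣≤ : ∣ B e m ∣≤ K + + q * R
    ∣Bem∣≤ = ∣∣≤-weaken (+-mono-≤ Ne≤K (≤-reflexive Nm≡qNt)) (B-bound₁ e m)
    ∣B∣< : ∣ B (t ⊕ e) m ∣< + 2 * normSq m
    ∣B∣< = subst (∣_∣< _) (sym (B-⊕ˡ t e m)) (∣∣≤-<-trans (∣∣≤-+ ∣Btm∣≤Nt ∣Bem∣≤) (begin-strict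
      R + (K + + q * R)               ≡⟨ +-assoc R K _ ⟨
      R + K + + q * R                 <⟨ +-monoˡ-< (+ q * R) short ⟩
      + q * R + + q * R               ≡⟨ identity (+ q * R) ⟩
      + 2 * (+ q * R)                 ≡⟨ cong (+ 2 *_) Nm≡qNt ⟨
      + 2 * normSq m                  ∎))
      where
      identity : ∀ x → x + x ≡ + 2 * x
      identity = solve-∀

  central-⊕-long : ∀ {m t e R K} → normSq t ≡ + q * R → normSq m ≡ + q * R → ∣ B t m ∣≤ + 2 * (+ q * R) - R →
                   normSq e ≤ K → + 6 * K < + q * R → + 4 * (+ q * K) < R → Central m (t ⊕ e)
  central-⊕-long {m} {t} {e} {R} {K} Nt≡qR Nm≡qR ∣Btm∣≤ Ne≤K 6K<qR 4qK<R = N< , ∣B∣<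
    where
    open ≤-Reasoning
    0≤2q : 0ℤ ≤ + 2 * + q
    0≤2q = *-nonNeg {+ 2} {+ q} (+≤+ ℕ.z≤n) (+≤+ ℕ.z≤n)
    N< : normSq (t ⊕ e) < + 2 * normSq m
    N< = *-cancelˡ-<-nonNeg (+ 2) (begin-strict
      + 2 * normSq (t ⊕ e)                                   ≡⟨ cong (+ 2 *_) (trans (N-⊕ t e) (cong (λ z → normSq t + z + normSq e) (B-comm t e))) ⟩
      + 2 * (normSq t + B e t + normSq e)                    ≡⟨ identity₁ (normSq t) (B e t) (normSq e) ⟩
      + 2 * B e t + (+ 2 * normSq t + + 2 * normSq e)        ≤⟨ +-monoˡ-≤ _ (proj₂ (B-bound (+ 2) e t)) ⟩
      + 4 * normSq e + normSq t + (+ 2 * normSq t + + 2 * normSq e) ≡⟨ identity₂ (normSq t) (normSq e) ⟩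
      + 3 * normSq t + + 6 * normSq e                        ≤⟨ +-monoʳ-≤ (+ 3 * normSq t) (*-monoˡ-≤-nonNeg (+ 6) Ne≤K) ⟩
      + 3 * normSq t + + 6 * K                               <⟨ +-monoʳ-< (+ 3 * normSq t) 6K<qR ⟩
      + 3 * normSq t + + q * R                               ≡⟨ cong (λ z → + 3 * z + + q * R) Nt≡qR ⟩
      + 3 * (+ q * R) + + q * R                              ≡⟨ identity₃ (+ q * R) ⟩
      + 2 * (+ 2 * (+ q * R))                                ≡⟨ cong (λ z → + 2 * (+ 2 * z)) Nm≡qR ⟨
      + 2 * (+ 2 * normSq m)                                 ∎)
      where
      identity₁ : ∀ A C D → + 2 * (A + C + D) ≡ + 2 * C + (+ 2 * A + + 2 * D)
      identity₁ = solve-∀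
      identity₂ : ∀ A D → + 4 * D + A + (+ 2 * A + + 2 * D) ≡ + 3 * A + + 6 * D
      identity₂ = solve-∀
      identity₃ : ∀ x → + 3 * x + x ≡ + 2 * (+ 2 * x)
      identity₃ = solve-∀
    -- Taking k = 2q in B-bound turns N e ≤ K and 4qK < R into ∣ B e m ∣< R.
    ∣2qBem∣< : ∣ (+ 2 * + q) * B e m ∣< (+ 2 * + q) * R
    ∣2qBem∣< = ∣∣≤-<-trans (B-bound (+ 2 * + q) e m) (begin-strict
      (+ 2 * + q) * (+ 2 * + q) * normSq e + normSq m        ≤⟨ +-mono-≤ (*-monoˡ-≤-nonNeg _ {{nonNegative (*-nonNeg 0≤2q 0≤2q)}} Ne≤K) (≤-reflexive Nm≡qR) ⟩
      (+ 2 * + q) * (+ 2 * + q) * K + + q * R                ≡⟨ identity₁ (+ q) K R ⟩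
      + q * (+ 4 * (+ q * K)) + + q * R                      <⟨ +-monoˡ-< _ (*-monoˡ-<-pos (+ q) {{positive (+<+ (ℕ.<-≤-trans (ℕ.s≤s ℕ.z≤n) 2≤q))}} 4qK<R) ⟩
      + q * R + + q * R                                      ≡⟨ identity₂ (+ q) R ⟩
      (+ 2 * + q) * R                                        ∎)
      where
      identity₁ : ∀ Q K R → (+ 2 * Q) * (+ 2 * Q) * K + Q * R ≡ Q * (+ 4 * (Q * K)) + Q * R
      identity₁ = solve-∀
      identity₂ : ∀ Q R → Q * R + Q * R ≡ (+ 2 * Q) * R
      identity₂ = solve-∀
    ∣B∣< : ∣ B (t ⊕ e) m ∣< + 2 * normSq m
    ∣B∣< = subst₂ ∣_∣<_ (sym (B-⊕ˡ t e m)) (trans (identity (+ q * R) R) (cong (+ 2 *_) (sym Nm≡qR)))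
      (∣∣≤-+-∣∣< ∣Btm∣≤ (∣∣<-cancel (+ 2 * + q) {{nonNegative 0≤2q}} ∣2qBem∣<))
      where
      identity : ∀ x R → + 2 * x - R + R ≡ + 2 * x
      identity = solve-∀

  N-τ^ : ∀ n → normSq (τ ^' n) ≡ + (q ℕ.^ n)
  N-τ^ ℕ.zero = N-real 1ℤ
  N-τ^ (ℕ.suc n) = trans (N-τ⊗ (τ ^' n)) (trans (cong (+ q *_) (N-τ^ n)) (sym (pos-* q (q ℕ.^ n))))

  central-τ-power : ∀ {v s e K} → IsSign s → normSq e ≤ K → normSq v + K < + q * normSq v →
                    Central (τ ⊗ v) ((s · v) ⊕ e)
  central-τ-power {v} {s} {e} {K} s-sign Ne≤K short =
    central-⊕-short {τ ⊗ v} {s · v} {e} {K} Nm≡qNt ∣Btm∣≤Nt Ne≤K (subst (λ R → R + K < + q * R) (sym (N-sign· s-sign v)) short)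
    where
    Nm≡qNt : normSq (τ ⊗ v) ≡ + q * normSq (s · v)
    Nm≡qNt = trans (N-τ⊗ v) (cong (+ q *_) (sym (N-sign· s-sign v)))
    ∣Btm∣≤Nt : ∣ B (s · v) (τ ⊗ v) ∣≤ normSq (s · v)
    ∣Btm∣≤Nt = subst₂ ∣_∣≤_ (sym (trans (B-·ˡ s v (τ ⊗ v)) (cong (s *_) (B-τ⊗ v)))) (sym (N-sign· s-sign v))
      (sign-∣∣≤ s-sign (sign-∣∣≤ p-sign (nonNeg⇒∣∣≤self (N-nonNeg v))))

  central-τbar-τ-power : ∀ {v s e K} → IsSign s → normSq e ≤ K → + 6 * K < + q * normSq v → + 4 * (+ q * K) < normSq v →
                         Central (τ ⊗ v) ((s · (τbar ⊗ v)) ⊕ e)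
  central-τbar-τ-power {v} {s} {e} {K} s-sign Ne≤K 6K<qR 4qK<R =
    central-⊕-long {τ ⊗ v} {s · (τbar ⊗ v)} {e} {normSq v} {K} (trans (N-sign· s-sign (τbar ⊗ v)) (N-τbar⊗ v)) (N-τ⊗ v) ∣Btm∣≤ Ne≤K 6K<qR 4qK<R
    where
    R : ℤ
    R = normSq v
    R≤2qR : R ≤ + 2 * (+ q * R)
    R≤2qR = begin
      R                     ≡⟨ *-identityˡ R ⟨
      1ℤ * R                ≤⟨ *-monoʳ-≤-nonNeg R {{nonNegative (N-nonNeg v)}} (≤-trans (+≤+ (ℕ.s≤s ℕ.z≤n)) (+≤+ 2≤q)) ⟩
      + q * R               ≤⟨ i≤j+i (+ q * R) (+ q * R) {{nonNegative (*-nonNeg {+ q} (+≤+ ℕ.z≤n) (N-nonNeg v))}} ⟩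
      + q * R + + q * R     ≡⟨ identity (+ q * R) ⟩
      + 2 * (+ q * R)       ∎
      where
      open ≤-Reasoning
      identity : ∀ x → x + x ≡ + 2 * x
      identity = solve-∀
    B≡ : B (s · (τbar ⊗ v)) (τ ⊗ v) ≡ s * (-1ℤ * (+ 2 * (+ q * R) - R))
    B≡ = trans (B-·ˡ s (τbar ⊗ v) (τ ⊗ v)) (cong (s *_) (trans (B-τbar⊗-τ⊗ v) (trans (cong (λ z → (z - + 2 * + q) * R) (sign*sign≡1 p-sign)) (identity (+ q) R))))
      where
      identity : ∀ Q R → (1ℤ - + 2 * Q) * R ≡ -1ℤ * (+ 2 * (Q * R) - R)
      identity = solve-∀
    ∣Btm∣≤ : ∣ B (s · (τbar ⊗ v)) (τ ⊗ v) ∣≤ + 2 * (+ q * R) - R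
    ∣Btm∣≤ = subst (∣_∣≤ + 2 * (+ q * R) - R) (sym B≡) (sign-∣∣≤ s-sign (sign-∣∣≤ (inj₂ refl) (nonNeg⇒∣∣≤self (i≤j⇒0≤j-i R≤2qR))))

  τ∣⇒q∣x : ∀ {α} → τ ∣' α → + q ∣ proj₁ α
  τ∣⇒q∣x ((c₁ , c₂) , refl) = divides (- c₂) (identity c₁ c₂ (+ q))
    where
    identity : ∀ c₁ c₂ Q → c₁ * 0ℤ - Q * (c₂ * 1ℤ) ≡ - c₂ * Q
    identity = solve-∀

  q∣x-⊗ : ∀ c {m} → + q ∣ proj₁ m → + q ∣ proj₁ (c ⊗ m)
  q∣x-⊗ (c₁ , c₂) {m₁ , m₂} q∣m₁ = ∣m∣n⇒∣m-n (∣n⇒∣m*n c₁ q∣m₁) (∣m⇒∣m*n (c₂ * m₂) ∣-refl)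

  q∣x-τ⊗ : ∀ v → + q ∣ proj₁ (τ ⊗ v)
  q∣x-τ⊗ (x , y) = ∣m∣n⇒∣m-n (∣m⇒∣m*n x (divides 0ℤ refl)) (∣m⇒∣m*n (1ℤ * y) ∣-refl)

  q∣x-τ^ : ∀ {n} → 1 ℕ.≤ n → + q ∣ proj₁ (τ ^' n)
  q∣x-τ^ {ℕ.suc n} _ = q∣x-τ⊗ (τ ^' n)

  q∤1 : ¬ (+ q ∣ 1ℤ)
  q∤1 q∣1 = ℕ.<-irrefl refl (subst (2 ℕ.≤_) (∣1⇒≡1 (∣⇒∣ᵤ q∣1)) 2≤q)

  halve : ∀ x → ∃ λ b → ∃ λ r → IsBit r × + 2 * b ≡ -1ℤ * x + r
  halve x = - k , + r , bit-of-<2 (DivMod.n%ℕd<d x 2) , trans (identity (+ r) k) (cong (λ z → -1ℤ * z + + r) (sym (DivMod.a≡a%ℕn+[a/ℕn]*n x 2)))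
    where
    k : ℤ
    k = x DivMod./ℕ 2
    r : ℕ
    r = x DivMod.%ℕ 2
    identity : ∀ r k → + 2 * (- k) ≡ -1ℤ * (r + k * + 2) + r
    identity = solve-∀

  halve-avoiding-q : ∀ x → ∃ λ b → ∃ λ e → ∃ λ r → IsBit r × (e ≡ r ⊎ e ≡ r - + 2) × + 2 * b ≡ -1ℤ * x + e × ¬ (+ q ∣ b)
  halve-avoiding-q x with halve x
  ... | b , r , r-bit , 2b≡-x+r with + q ∣? b
  ...   | no q∤b = b , r , r , r-bit , inj₁ refl , 2b≡-x+r , q∤b
  ...   | yes q∣b = b - 1ℤ , r - + 2 , r , r-bit , inj₂ refl , 2[b-1]≡-x+r-2 , q∤b-1
    where
    2[b-1]≡-x+r-2 : + 2 * (b - 1ℤ) ≡ -1ℤ * x + (r - + 2)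
    2[b-1]≡-x+r-2 = trans (identity₁ b) (trans (cong (_- + 2) 2b≡-x+r) (identity₂ (-1ℤ * x) r))
      where
      identity₁ : ∀ b → + 2 * (b - 1ℤ) ≡ + 2 * b - + 2
      identity₁ = solve-∀
      identity₂ : ∀ y r → y + r - + 2 ≡ y + (r - + 2)
      identity₂ = solve-∀
    q∤b-1 : ¬ (+ q ∣ b - 1ℤ)
    q∤b-1 q∣b-1 = q∤1 (subst (+ q ∣_) (identity b) (∣m∣n⇒∣m-n q∣b q∣b-1))
      where
      identity : ∀ b → b - (b - 1ℤ) ≡ 1ℤ
      identity = solve-∀

  N-error≤ : ∀ {r e₁ e₂} → IsBit r → (e₁ ≡ r ⊎ e₁ ≡ r - + 2) → IsBit e₂ → normSq (e₁ , e₂) ≤ + 6 + + q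
  N-error≤ r-bit e₁≡ e₂-bit = +-mono-≤ (error-quadratic≤6 p-sign r-bit e₁≡ e₂-bit) (q-part e₂-bit)
    where
    q-part : ∀ {e} → IsBit e → + q * (e * e) ≤ + q
    q-part (inj₁ refl) = subst (_≤ + q) (sym (*-zeroʳ (+ q))) (+≤+ ℕ.z≤n)
    q-part (inj₂ refl) = ≤-reflexive (*-identityʳ (+ q))

  round-half : ∀ t → ∃ λ b → ∃ λ e → + 2 · b ≡ (-1ℤ · t) ⊕ e × ¬ (+ q ∣ proj₁ b) × normSq e ≤ + 6 + + q
  round-half (t₁ , t₂) with halve-avoiding-q t₁ | halve t₂
  ... | b₁ , e₁ , r , r-bit , e₁≡ , eq₁ , q∤b₁ | b₂ , e₂ , e₂-bit , eq₂ =
    (b₁ , b₂) , (e₁ , e₂) , cong₂ _,_ eq₁ eq₂ , q∤b₁ , N-error≤ r-bit e₁≡ e₂-bit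

  module DigitSet {w : ℕ} {D : Zτ → Set} (isD : IsMinNormDigitSet (ℕ.suc w) D) where
    open IsMinNormDigitSet isD

    strictlyMinimal⇒∈D : ∀ {α} → ¬ (+ q ∣ proj₁ α) → StrictlyMinimal (τ ^' ℕ.suc w) α → D α
    strictlyMinimal⇒∈D {α} q∤α α-minimal with covers α (q∤α ∘ τ∣⇒q∣x)
    ... | d , d∈D , (c , cM≡d⊖α) = congruent⇒∈D d∈D c cM≡d⊖α (trans (cong (α ⊕_) cM≡d⊖α) (⊕-⊖-cancel α d))
      where
      congruent⇒∈D : ∀ {d} → D d → ∀ c → c ⊗ (τ ^' ℕ.suc w) ≡ d ⊖ α → α ⊕ (c ⊗ (τ ^' ℕ.suc w)) ≡ d → D α
      congruent⇒∈D {d} d∈D c cM≡d⊖α α⊕cM≡d with members d d∈D | ≡-dec _≟_ _≟_ c zero'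
      ... | inj₁ d≡0 | _ =
        ⊥-elim (q∤α (∣m+n∣n⇒∣m (divides 0ℤ (cong proj₁ (trans α⊕cM≡d d≡0))) (q∣x-⊗ c (q∣x-τ⊗ (τ ^' w)))))
      ... | inj₂ _ | yes refl = subst D (trans (sym α⊕cM≡d) (⊕-zero⊗ α (τ ^' ℕ.suc w))) d∈D
      ... | inj₂ τ∤d | no c≢0 =
        ⊥-elim (<⇒≱ (subst (λ z → normSq α < normSq z) α⊕cM≡d (α-minimal c c≢0)) (minimal d d∈D τ∤d α (-1ℤ · c , [-c]M≡α⊖d)))
        where
        [-c]M≡α⊖d : (-1ℤ · c) ⊗ (τ ^' ℕ.suc w) ≡ α ⊖ d
        [-c]M≡α⊖d = trans (·-⊗ -1ℤ c _) (trans (cong (-1ℤ ·_) cM≡d⊖α) (-1·-⊖ α d))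

    central⇒∈D : ∀ {α} → ¬ (+ q ∣ proj₁ α) → Central (τ ^' ℕ.suc w) (+ 2 · α) → D α
    central⇒∈D {α} q∤α = strictlyMinimal⇒∈D q∤α ∘ central⇒strictlyMinimal {τ ^' ℕ.suc w} {α}

    digit-pair : ∀ t → + q ∣ proj₁ t →
                 (∀ s e → IsSign s → normSq e ≤ + 6 + + q → Central (τ ^' ℕ.suc w) ((s · t) ⊕ e)) →
                 ∃ λ a → D a × D (a ⊕ t)
    digit-pair t q∣t central with round-half t
    ... | b , e , 2b≡-t+e , q∤b , e-small =
        b
      , central⇒∈D q∤b (subst (Central (τ ^' ℕ.suc w)) (sym 2b≡-t+e) (central -1ℤ e (inj₂ refl) e-small))
      , central⇒∈D (q∤b ∘ λ q∣b+t → ∣m+n∣n⇒∣m q∣b+t q∣t) (subst (Central (τ ^' ℕ.suc w)) (sym 2[b+t]≡t+e) (central 1ℤ e (inj₁ refl) e-small))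
      where
      2[b+t]≡t+e : + 2 · (b ⊕ t) ≡ (1ℤ · t) ⊕ e
      2[b+t]≡t+e = cong₂ _,_ (shift-half (cong proj₁ 2b≡-t+e)) (shift-half (cong proj₂ 2b≡-t+e))

proposition15p3 : (p : ℤ) (q w : ℕ) → (p ≡ 1ℤ ⊎ p ≡ -1ℤ) → 2 ℕ.≤ q → 2 ℕ.≤ w →
    (D : Zτ → Set) → Arith.IsMinNormDigitSet p (+ q) w D →
    ((5 ℕ.≤ w ⊎ 5 ℕ.≤ q) →
      ∃ λ a → D a × D (Arith._⊕_ p (+ q) a (Arith._^'_ p (+ q) (Arith.τ p (+ q)) (w ℕ.∸ 1))))
    × (((4 ℕ.≤ w × 11 ℕ.≤ q) ⊎ 8 ℕ.≤ w) →
      ∃ λ b → D b × D (Arith._⊕_ p (+ q) b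
        (Arith._⊗_ p (+ q) (Arith.τbar p (+ q)) (Arith._^'_ p (+ q) (Arith.τ p (+ q)) (w ℕ.∸ 1)))))
proposition15p3 p q (ℕ.suc w) p-sign 2≤q (ℕ.s≤s 1≤w) D isD = part₁ , part₂
  where
  open Arith p (+ q)
  open NormForm p (+ q)
  open Digits p q p-sign 2≤q
  open DigitSet isD
  open Margins

  v : Zτ
  v = τ ^' w
  r : ℕ
  r = q ℕ.^ w

  part₁ : 5 ℕ.≤ ℕ.suc w ⊎ 5 ℕ.≤ q → ∃ λ a → D a × D (a ⊕ v)
  part₁ hyp = digit-pair v (q∣x-τ^ 1≤w) λ _ _ s-sign e-small → central-τ-power s-sign e-small short
    where
    short : normSq v + (+ 6 + + q) < + q * normSq v
    short = subst (λ R → R + (+ 6 + + q) < + q * R) (sym (N-τ^ w))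
              (subst (+ (r ℕ.+ (6 ℕ.+ q)) <_) (pos-* q r) (+<+ (τ-power-short-margin 2≤q 1≤w hyp)))

  part₂ : (4 ℕ.≤ ℕ.suc w × 11 ℕ.≤ q) ⊎ 8 ℕ.≤ ℕ.suc w → ∃ λ b → D b × D (b ⊕ (τbar ⊗ v))
  part₂ hyp = digit-pair (τbar ⊗ v) (q∣x-⊗ τbar (q∣x-τ^ 1≤w)) λ _ _ s-sign e-small →
    central-τbar-τ-power s-sign e-small six four
    where
    long : 4 ℕ.* (q ℕ.* (6 ℕ.+ q)) ℕ.< r
    long = τ-power-long-margin 2≤q hyp
    four : + 4 * (+ q * (+ 6 + + q)) < normSq v
    four = subst₂ _<_ (trans (pos-* 4 (q ℕ.* (6 ℕ.+ q))) (cong (+ 4 *_) (pos-* q (6 ℕ.+ q)))) (sym (N-τ^ w)) (+<+ long)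
    six : + 6 * (+ 6 + + q) < + q * normSq v
    six = subst₂ _<_ (pos-* 6 (6 ℕ.+ q)) (trans (pos-* q r) (cong (+ q *_) (sym (N-τ^ w)))) (+<+ (long-margin⇒six-margin 2≤q long))
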